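{- For every $n>60$, if $f,g:[n]\to[n]$ are two permutations chosen uniformly at random and independently, then with probability more than $1-\frac{1}{12}$ the string $(f,g)\in[n]^{2n}$ is $\frac15$-far from $\mathbf{inv}$.
   Context: $\mathbf{inv}$ is the property of strings in $[n]^{2n}$, viewed as pairs $(f,g)$ of functions $[n]\to[n]$ (first $n$ symbols give $f$, last $n$ give $g$), such that either $f(i)=g(i)$ for all $i\in[n]$ or $g(f(i))=i$ for all $i\in[n]$. Distance is the normalized Hamming distance on $[n]^{2n}$; a string is $\varepsilon$-far from $\mathbf{inv}$ if its distance to every member of $\mathbf{inv}$ is greater than $\varepsilon$. -}

module Defs where

open import Data.Nat using (ℕ; zero; suc; _+_; _*_; _<_)
open import Data.Fin using (Fin; _↑ˡ_; _↑ʳ_) renaming (_≟_ to _≟F_; zero to fzero; suc to fsuc)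
open import Data.Vec using (Vec; lookup)
open import Data.Sum using (_⊎_)
open import Data.Product using (_×_)
open import Data.Bool using (Bool; if_then_else_)
open import Relation.Binary.PropositionalEquality using (_≡_)
open import Relation.Nullary.Decidable using (does)

Str : ℕ → Set
Str n = Vec (Fin n) (n + n)

fOf : ∀ {n} → Str n → Fin n → Fin n
fOf {n} s i = lookup s (i ↑ˡ n)

gOf : ∀ {n} → Str n → Fin n → Fin n
gOf {n} s i = lookup s (n ↑ʳ i)

Inv : ∀ {n} → Str n → Set
Inv {n} s = (∀ (i : Fin n) → fOf s i ≡ gOf s i) ⊎ (∀ (i : Fin n) → gOf s (fOf s i) ≡ i)

countFin : (m : ℕ) → (Fin m → Bool) → ℕ
countFin zero    b = 0
countFin (suc m) b = (if b fzero then 1 else 0) + countFin m (λ i → b (fsuc i))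

hamming : ∀ {k L} → Vec (Fin k) L → Vec (Fin k) L → ℕ
hamming {k} {L} s t = countFin L (λ i → if does (lookup s i ≟F lookup t i) then Bool.false else Bool.true)

-- s is ε-far from inv, with ε = p / q (q > 0): the normalized Hamming distance
-- hamming s t / (n + n) is > p / q for every t ∈ inv, i.e. p * (n + n) < q * hamming s t.
FarFromInv : (p q : ℕ) → ∀ {n} → Str n → Set
FarFromInv p q {n} s = ∀ (t : Str n) → Inv t → p * (n + n) < q * hamming s t

IsPerm : ∀ {n} → (Fin n → Fin n) → Set
IsPerm {n} h = (∀ (i j : Fin n) → h i ≡ h j → i ≡ j) × (∀ (y : Fin n) → Data.Product.∃ (λ x → h x ≡ y))
  where import Data.Product

PermPair : ∀ {n} → Str n → Set
PermPair s = IsPerm (fOf s) × IsPerm (gOf s)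

-- Call i a coincidence of (f, g) if g i = f i, or if g (f i) = i.  Each alternative of
-- inv fails at every non-coincidence, and changing f and g in h places repairs at most h of
-- these failures, so a pair with fewer than 3n/5 coincidences is 1/5-far from inv.  The
-- expected number of coincidences is 2: replacing g by rotate r ∘ g and summing over the
-- n rotations r, every equation rotate r x = y has exactly one solution r.  By Markov's
-- inequality at most a 10/(3n) < 1/12 fraction of the pairs has 3n/5 or more coincidences.

module Submission where

open import Defs
open import Data.Bool using (Bool; true; false; if_then_else_)
open import Data.Empty using (⊥-elim)
open import Data.Fin using (Fin; zero; suc; toℕ; fromℕ<; lift; punchIn; punchOut; _↑ˡ_; _↑ʳ_; _≟_)
open import Data.Fin.Permutation using (Permutation′; permutation)
open import Data.Fin.Properties
  using ( toℕ<n; toℕ-fromℕ<; toℕ-injective; suc-injective; lift-injective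
        ; punchInᵢ≢i; punchOut-injective; injective⇒≤; any?)
open import Data.List using (List; []; _∷_; [_]; _++_; length; map; filter; cartesianProduct; allFin; tabulate)
open import Data.List.Properties using (length-++; length-map; length-tabulate)
open import Data.List.Relation.Unary.All as All using (All)
open import Data.List.Relation.Unary.All.Properties using (all-filter) renaming (map⁺ to All-map⁺)
open import Data.List.Relation.Unary.AllPairs using ([]; _∷_)
open import Data.List.Relation.Unary.Unique.Propositional using (Unique)
open import Data.List.Relation.Unary.Unique.Propositional.Properties
  using (map⁺; filter⁺; cartesianProduct⁺; allFin⁺)
open import Data.Nat using (ℕ; NonZero; zero; suc; _+_; _*_; _∸_; _<_; _≤_; z≤n; s≤s; _<?_; _!)
open import Data.Nat.Properties hiding (_≟_; suc-injective)
open import Data.Nat.Tactic.RingSolver using (solve-∀)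
open import Data.Product using (Σ; ∃; _×_; _,_; proj₁; proj₂)
open import Data.Sum using (_⊎_; inj₁; inj₂)
open import Data.Unit using (⊤; tt)
import Data.Vec as Vec
open import Data.Vec.Properties using (lookup-++ˡ; lookup-++ʳ; lookup∘tabulate; ++-injective)
open import Function using (_∘_; id)
open import Function.Definitions using (Injective)
open import Relation.Binary.PropositionalEquality hiding ([_])
open import Relation.Nullary using (Dec; yes; no; does; contradiction)
open import Relation.Nullary.Decidable using (dec-true; dec-false)

open import Algebra.Properties.CommutativeMonoid.Sum +-0-commutativeMonoid
  using (sum; sum-syntax; sum-cong-≗; sum-remove; sum-replicate-zero; ∑-distrib-+; ∑-comm; sum-permute)

∑-const : ∀ n k → ∑[ i < n ] k ≡ n * k
∑-const zero    k = refl
∑-const (suc n) k = cong (k +_) (∑-const n k)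

∑-mono-≤ : ∀ {n} {f g : Fin n → ℕ} → (∀ i → f i ≤ g i) → sum f ≤ sum g
∑-mono-≤ {zero}  f≤g = z≤n
∑-mono-≤ {suc n} f≤g = +-mono-≤ (f≤g zero) (∑-mono-≤ (f≤g ∘ suc))

∑-splitAt : ∀ m n (f : Fin (m + n) → ℕ) → sum f ≡ ∑[ i < m ] f (i ↑ˡ n) + ∑[ j < n ] f (m ↑ʳ j)
∑-splitAt zero    n f = refl
∑-splitAt (suc m) n f = trans (cong (f zero +_) (∑-splitAt m n (f ∘ suc))) (sym (+-assoc (f zero) _ _))

injective⇒surjective : ∀ {n} {h : Fin n → Fin n} → Injective _≡_ _≡_ h → ∀ y → ∃ λ x → h x ≡ y
injective⇒surjective {suc n} {h} inj y with any? (λ x → h x ≟ y)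
... | yes hit  = hit
... | no  miss = ⊥-elim (1+n≰n (injective⇒≤ {f = λ x → punchOut (y≢h x)}
                                           (inj ∘ punchOut-injective (y≢h _) (y≢h _))))
  where
  y≢h : ∀ x → y ≢ h x
  y≢h x y≡hx = miss (x , sym y≡hx)

∑-reindex : ∀ {n} (f : Fin n → ℕ) {h : Fin n → Fin n} → Injective _≡_ _≡_ h → ∑[ i < n ] f (h i) ≡ sum f
∑-reindex f {h} inj = sym (sum-permute f π)
  where
  surj = injective⇒surjective inj
  π : Permutation′ _
  π = permutation h (proj₁ ∘ surj) (proj₂ ∘ surj) (λ x → inj (proj₂ (surj (h x))))

𝟙 : Bool → ℕ
𝟙 b = if b then 1 else 0

_≡ᵇ_ _≢ᵇ_ : ∀ {n} → Fin n → Fin n → Bool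
x ≡ᵇ y = does (x ≟ y)
x ≢ᵇ y = if does (x ≟ y) then false else true

countFin≡∑ : ∀ m (b : Fin m → Bool) → countFin m b ≡ ∑[ i < m ] 𝟙 (b i)
countFin≡∑ zero    b = refl
countFin≡∑ (suc m) b = cong (𝟙 (b zero) +_) (countFin≡∑ m (b ∘ suc))

𝟙-≡ᵇ-≡ : ∀ {n} {x y : Fin n} → x ≡ y → 𝟙 (x ≡ᵇ y) ≡ 1
𝟙-≡ᵇ-≡ {x = x} {y} x≡y = cong 𝟙 (dec-true (x ≟ y) x≡y)

𝟙-≡ᵇ-≢ : ∀ {n} {x y : Fin n} → x ≢ y → 𝟙 (x ≡ᵇ y) ≡ 0
𝟙-≡ᵇ-≢ {x = x} {y} x≢y = cong 𝟙 (dec-false (x ≟ y) x≢y)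

𝟙-≢ᵇ+𝟙-≡ᵇ : ∀ {n} (x y : Fin n) → 𝟙 (x ≢ᵇ y) + 𝟙 (x ≡ᵇ y) ≡ 1
𝟙-≢ᵇ+𝟙-≡ᵇ x y with does (x ≟ y)
... | true  = refl
... | false = refl

𝟙-≢ᵇ-sym : ∀ {n} (x y : Fin n) → 𝟙 (x ≢ᵇ y) ≡ 𝟙 (y ≢ᵇ x)
𝟙-≢ᵇ-sym x y with x ≟ y | y ≟ x
... | yes _   | yes _   = refl
... | no  _   | no  _   = refl
... | yes x≡y | no  y≢x = contradiction (sym x≡y) y≢x
... | no  x≢y | yes y≡x = contradiction (sym y≡x) x≢y

𝟙-≢ᵇ-triangle : ∀ {n} (x y z : Fin n) → 𝟙 (x ≢ᵇ z) ≤ 𝟙 (x ≢ᵇ y) + 𝟙 (y ≢ᵇ z)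
𝟙-≢ᵇ-triangle x y z with x ≟ z | x ≟ y | y ≟ z
... | yes _   | _       | _       = z≤n
... | no  _   | no  _   | _       = s≤s z≤n
... | no  _   | yes _   | no  _   = ≤-refl
... | no  x≢z | yes x≡y | yes y≡z = contradiction (trans x≡y y≡z) x≢z

𝟙-≢ᵇ-∘ : ∀ {m n} (k : Fin m → Fin n) (x y : Fin m) → 𝟙 (k x ≢ᵇ k y) ≤ 𝟙 (x ≢ᵇ y)
𝟙-≢ᵇ-∘ k x y with k x ≟ k y | x ≟ y
... | yes _     | _       = z≤n
... | no  _     | no  _   = ≤-refl
... | no  kx≢ky | yes x≡y = contradiction (cong k x≡y) kx≢ky

∑-𝟙-≡ᵇ : ∀ {n} (y : Fin n) → ∑[ x < n ] 𝟙 (x ≡ᵇ y) ≡ 1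
∑-𝟙-≡ᵇ {suc n} y = begin
  ∑[ x < suc n ] 𝟙 (x ≡ᵇ y)
    ≡⟨ sum-remove {i = y} (λ x → 𝟙 (x ≡ᵇ y)) ⟩
  𝟙 (y ≡ᵇ y) + ∑[ j < n ] 𝟙 (punchIn y j ≡ᵇ y)
    ≡⟨ cong₂ _+_ (𝟙-≡ᵇ-≡ {x = y} refl) punched-out ⟩
  1
    ∎
  where
  open ≡-Reasoning
  punched-out : ∑[ j < n ] 𝟙 (punchIn y j ≡ᵇ y) ≡ 0
  punched-out = trans (sum-cong-≗ (λ j → 𝟙-≡ᵇ-≢ (punchInᵢ≢i y j))) (sum-replicate-zero n)

∑-𝟙-hits : ∀ {n} {h : Fin n → Fin n} → Injective _≡_ _≡_ h → ∀ y → ∑[ x < n ] 𝟙 (h x ≡ᵇ y) ≡ 1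
∑-𝟙-hits inj y = trans (∑-reindex (λ z → 𝟙 (z ≡ᵇ y)) inj) (∑-𝟙-≡ᵇ y)

matches mismatches : ∀ {m n} → (Fin m → Fin n) → (Fin m → Fin n) → ℕ
matches    {m} f g = ∑[ i < m ] 𝟙 (f i ≡ᵇ g i)
mismatches {m} f g = ∑[ i < m ] 𝟙 (f i ≢ᵇ g i)

module _ {m n : ℕ} where

  mismatches+matches : (f g : Fin m → Fin n) → mismatches f g + matches f g ≡ m
  mismatches+matches f g = begin
    mismatches f g + matches f g
      ≡⟨ ∑-distrib-+ (λ i → 𝟙 (f i ≢ᵇ g i)) (λ i → 𝟙 (f i ≡ᵇ g i)) ⟨
    ∑[ i < m ] (𝟙 (f i ≢ᵇ g i) + 𝟙 (f i ≡ᵇ g i))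
      ≡⟨ sum-cong-≗ (λ i → 𝟙-≢ᵇ+𝟙-≡ᵇ (f i) (g i)) ⟩
    ∑[ i < m ] 1
      ≡⟨ ∑-const m 1 ⟩
    m * 1
      ≡⟨ *-identityʳ m ⟩
    m
      ∎
    where open ≡-Reasoning

  matches-cong : {f f′ g g′ : Fin m → Fin n} → (∀ i → f i ≡ f′ i) → (∀ i → g i ≡ g′ i) →
    matches f g ≡ matches f′ g′
  matches-cong f≗f′ g≗g′ = sum-cong-≗ (λ i → cong₂ (λ x y → 𝟙 (x ≡ᵇ y)) (f≗f′ i) (g≗g′ i))

  mismatches-congʳ : (f : Fin m → Fin n) {g g′ : Fin m → Fin n} → (∀ i → g i ≡ g′ i) →
    mismatches f g ≡ mismatches f g′
  mismatches-congʳ f g≗g′ = sum-cong-≗ (λ i → cong (λ y → 𝟙 (f i ≢ᵇ y)) (g≗g′ i))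

  mismatches-sym : (f g : Fin m → Fin n) → mismatches f g ≡ mismatches g f
  mismatches-sym f g = sum-cong-≗ (λ i → 𝟙-≢ᵇ-sym (f i) (g i))

  mismatches-triangle : (f g h : Fin m → Fin n) → mismatches f h ≤ mismatches f g + mismatches g h
  mismatches-triangle f g h = ≤-trans
    (∑-mono-≤ (λ i → 𝟙-≢ᵇ-triangle (f i) (g i) (h i)))
    (≤-reflexive (∑-distrib-+ (λ i → 𝟙 (f i ≢ᵇ g i)) (λ i → 𝟙 (g i ≢ᵇ h i))))

  mismatches-∘ˡ : ∀ {k} (q : Fin n → Fin k) (f g : Fin m → Fin n) → mismatches (q ∘ f) (q ∘ g) ≤ mismatches f g
  mismatches-∘ˡ q f g = ∑-mono-≤ (λ i → 𝟙-≢ᵇ-∘ q (f i) (g i))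

mismatches-∘ʳ : ∀ {m n} (f g : Fin m → Fin n) {h : Fin m → Fin m} → Injective _≡_ _≡_ h →
  mismatches (f ∘ h) (g ∘ h) ≡ mismatches f g
mismatches-∘ʳ f g inj = ∑-reindex (λ i → 𝟙 (f i ≢ᵇ g i)) inj

-- Few coincidences force distance from inv

hamming≡mismatches : ∀ {n} (s t : Str n) →
  hamming s t ≡ mismatches (fOf s) (fOf t) + mismatches (gOf s) (gOf t)
hamming≡mismatches {n} s t = trans (countFin≡∑ (n + n) _) (∑-splitAt n n _)

coincidences : ∀ {n} → (Fin n → Fin n) → (Fin n → Fin n) → ℕ
coincidences f g = matches g f + matches (g ∘ f) id

coincidences-cong : ∀ {n} {f f′ g g′ : Fin n → Fin n} → (∀ i → f i ≡ f′ i) → (∀ i → g i ≡ g′ i) →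
  coincidences f g ≡ coincidences f′ g′
coincidences-cong {f = f} {f′} {g} f≗f′ g≗g′ =
  cong₂ _+_ (matches-cong g≗g′ f≗f′)
            (matches-cong (λ i → trans (cong g (f≗f′ i)) (g≗g′ (f′ i))) (λ _ → refl))

module _ {n : ℕ} (s t : Str n) where

  private
    f g F G : Fin n → Fin n
    f = fOf s
    g = gOf s
    F = fOf t
    G = gOf t

  mismatches≤hamming-equal : (∀ i → F i ≡ G i) → mismatches g f ≤ hamming s t
  mismatches≤hamming-equal F≗G = begin
    mismatches g f                       ≤⟨ mismatches-triangle g G f ⟩
    mismatches g G + mismatches G f      ≡⟨ cong (mismatches g G +_) Gf≡fF ⟩
    mismatches g G + mismatches f F      ≡⟨ +-comm (mismatches g G) (mismatches f F) ⟩
    mismatches f F + mismatches g G      ≡⟨ hamming≡mismatches s t ⟨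
    hamming s t                          ∎
    where
    open ≤-Reasoning
    Gf≡fF : mismatches G f ≡ mismatches f F
    Gf≡fF = trans (mismatches-sym G f) (mismatches-congʳ f (λ i → sym (F≗G i)))

  mismatches≤hamming-inverse : (∀ i → G (F i) ≡ i) → mismatches (g ∘ f) id ≤ hamming s t
  mismatches≤hamming-inverse G∘F≗id = begin
    mismatches (g ∘ f) id                              ≤⟨ mismatches-triangle (g ∘ f) (g ∘ F) id ⟩
    mismatches (g ∘ f) (g ∘ F) + mismatches (g ∘ F) id  ≤⟨ +-monoˡ-≤ _ (mismatches-∘ˡ g f F) ⟩
    mismatches f F + mismatches (g ∘ F) id             ≡⟨ cong (mismatches f F +_) reindexed ⟩
    mismatches f F + mismatches g G                    ≡⟨ hamming≡mismatches s t ⟨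
    hamming s t                                        ∎
    where
    open ≤-Reasoning
    F-injective : Injective _≡_ _≡_ F
    F-injective {x} {y} Fx≡Fy = trans (sym (G∘F≗id x)) (trans (cong G Fx≡Fy) (G∘F≗id y))
    reindexed : mismatches (g ∘ F) id ≡ mismatches g G
    reindexed = trans (mismatches-congʳ (g ∘ F) (λ i → sym (G∘F≗id i))) (mismatches-∘ʳ g G F-injective)

  n≤hamming+coincidences : Inv t → n ≤ hamming s t + coincidences f g
  n≤hamming+coincidences (inj₁ F≗G) = begin
    n                                  ≡⟨ mismatches+matches g f ⟨
    mismatches g f + matches g f       ≤⟨ +-mono-≤ (mismatches≤hamming-equal F≗G) (m≤m+n _ _) ⟩
    hamming s t + coincidences f g     ∎
    where open ≤-Reasoning
  n≤hamming+coincidences (inj₂ G∘F≗id) = begin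
    n                                            ≡⟨ mismatches+matches (g ∘ f) id ⟨
    mismatches (g ∘ f) id + matches (g ∘ f) id
      ≤⟨ +-mono-≤ (mismatches≤hamming-inverse G∘F≗id) (m≤n+m _ _) ⟩
    hamming s t + coincidences f g               ∎
    where open ≤-Reasoning

few-coincidences⇒far : ∀ {n} (s : Str n) → 5 * coincidences (fOf s) (gOf s) < 3 * n → FarFromInv 1 5 s
few-coincidences⇒far {n} s 5C<3n t t∈inv = +-cancelʳ-< (3 * n) (1 * (n + n)) (5 * H) (begin-strict
  1 * (n + n) + 3 * n  ≡⟨ five-n n ⟩
  5 * n                ≤⟨ *-monoʳ-≤ 5 (n≤hamming+coincidences s t t∈inv) ⟩
  5 * (H + C)          ≡⟨ *-distribˡ-+ 5 H C ⟩
  5 * H + 5 * C        <⟨ +-monoʳ-< (5 * H) 5C<3n ⟩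
  5 * H + 3 * n        ∎)
  where
  open ≤-Reasoning
  H = hamming s t
  C = coincidences (fOf s) (gOf s)
  five-n : ∀ n → 1 * (n + n) + 3 * n ≡ 5 * n
  five-n = solve-∀

wrap : ∀ {n} (s : ℕ) → .(s < n + n) → Fin n
wrap {n} s s<n+n with s <? n
... | yes s<n = fromℕ< s<n
... | no  s≮n = fromℕ< (+-cancelˡ-< n (s ∸ n) n (subst (_< n + n) (sym (m+[n∸m]≡n (≮⇒≥ s≮n))) s<n+n))

toℕ-wrap : ∀ {n} s .(p : s < n + n) → toℕ (wrap {n} s p) ≡ s ⊎ toℕ (wrap {n} s p) + n ≡ s
toℕ-wrap {n} s p with s <? n
... | yes s<n = inj₁ (toℕ-fromℕ< s<n)
... | no  s≮n = inj₂ (trans (cong (_+ n) (toℕ-fromℕ< _)) (m∸n+n≡m (≮⇒≥ s≮n)))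

wrap-injective : ∀ {n} s s′ .(p : s < n + n) .(p′ : s′ < n + n) → wrap {n} s p ≡ wrap s′ p′ →
  s ≡ s′ ⊎ s + n ≡ s′ ⊎ s′ + n ≡ s
wrap-injective {n} s s′ p p′ eq with toℕ-wrap s p | toℕ-wrap s′ p′
... | inj₁ w≡s   | inj₁ w′≡s′  = inj₁ (trans (sym w≡s) (trans (cong toℕ eq) w′≡s′))
... | inj₂ w+n≡s | inj₂ w′+n≡s′ =
  inj₁ (trans (sym w+n≡s) (trans (cong (λ w → toℕ w + n) eq) w′+n≡s′))
... | inj₁ w≡s   | inj₂ w′+n≡s′ =
  inj₂ (inj₁ (trans (cong (_+ n) (trans (sym w≡s) (cong toℕ eq))) w′+n≡s′))
... | inj₂ w+n≡s | inj₁ w′≡s′  =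
  inj₂ (inj₂ (trans (cong (_+ n) (trans (sym w′≡s′) (cong toℕ (sym eq)))) w+n≡s))

rotate : ∀ {n} → Fin n → Fin n → Fin n
rotate r a = wrap (toℕ r + toℕ a) (+-mono-< (toℕ<n r) (toℕ<n a))

rotate-comm : ∀ {n} (r a : Fin n) → rotate r a ≡ rotate a r
rotate-comm {n} r a = wrap-cong (+-comm (toℕ r) (toℕ a))
  where
  wrap-cong : ∀ {s s′} → s ≡ s′ → .{p : s < n + n} .{p′ : s′ < n + n} → wrap {n} s p ≡ wrap s′ p′
  wrap-cong refl = refl

k+m+n≢k+toℕ : ∀ {n} k m (y : Fin n) → k + m + n ≢ k + toℕ y
k+m+n≢k+toℕ {n} k m y eq = <⇒≱ (toℕ<n y) (begin
  n          ≤⟨ m≤n+m n m ⟩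
  m + n      ≡⟨ +-cancelˡ-≡ k _ _ (trans (sym (+-assoc k m n)) eq) ⟩
  toℕ y      ∎)
  where open ≤-Reasoning

rotate-injectiveʳ : ∀ {n} (r : Fin n) → Injective _≡_ _≡_ (rotate r)
rotate-injectiveʳ r {a} {b} eq with wrap-injective _ _ _ _ eq
... | inj₁ r+a≡r+b          = toℕ-injective (+-cancelˡ-≡ (toℕ r) _ _ r+a≡r+b)
... | inj₂ (inj₁ r+a+n≡r+b) = contradiction r+a+n≡r+b (k+m+n≢k+toℕ (toℕ r) (toℕ a) b)
... | inj₂ (inj₂ r+b+n≡r+a) = contradiction r+b+n≡r+a (k+m+n≢k+toℕ (toℕ r) (toℕ b) a)

rotate-injectiveˡ : ∀ {n} (a : Fin n) → Injective _≡_ _≡_ (λ r → rotate r a)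
rotate-injectiveˡ a {r} {r′} eq = rotate-injectiveʳ a (trans (rotate-comm a r) (trans eq (rotate-comm r′ a)))

-- (c , r) encodes the permutation that fixes 0, permutes the rest by c and then rotates by r;
-- the k! codes give k! distinct permutations, hence all of them.
Code : ℕ → Set
Code zero    = ⊤
Code (suc k) = Code k × Fin (suc k)

decode : ∀ {k} → Code k → Fin k → Fin k
decode {zero}  _       = id
decode {suc k} (c , r) = rotate r ∘ lift 1 (decode c)

decode-injective : ∀ {k} (c : Code k) → Injective _≡_ _≡_ (decode c)
decode-injective {zero}  _       eq = eq
decode-injective {suc k} (c , r) eq = lift-injective (decode c) (decode-injective c) 1 (rotate-injectiveʳ r eq)

decode-≗-injective : ∀ {k} {c c′ : Code k} → (∀ i → decode c i ≡ decode c′ i) → c ≡ c′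
decode-≗-injective {zero}                    _  = refl
decode-≗-injective {suc k} {c , r} {c′ , r′} eq with refl ← rotate-injectiveˡ zero {r} {r′} (eq zero) =
  cong (_, r) (decode-≗-injective (λ i → suc-injective (rotate-injectiveʳ r (eq (suc i)))))

allCodes : ∀ k → List (Code k)
allCodes zero    = [ tt ]
allCodes (suc k) = cartesianProduct (allCodes k) (allFin (suc k))

allCodes-unique : ∀ k → Unique (allCodes k)
allCodes-unique zero    = All.[] ∷ []
allCodes-unique (suc k) = cartesianProduct⁺ (allCodes-unique k) (allFin⁺ (suc k))

length-cartesianProduct : ∀ {A B : Set} (xs : List A) (ys : List B) →
  length (cartesianProduct xs ys) ≡ length xs * length ys
length-cartesianProduct []       ys = refl
length-cartesianProduct (x ∷ xs) ys = trans (length-++ (map (x ,_) ys))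
  (cong₂ _+_ (length-map (x ,_) ys) (length-cartesianProduct xs ys))

length-allCodes : ∀ k → length (allCodes k) ≡ k !
length-allCodes zero    = refl
length-allCodes (suc k) = begin
  length (cartesianProduct (allCodes k) (allFin (suc k)))  ≡⟨ length-cartesianProduct (allCodes k) (allFin (suc k)) ⟩
  length (allCodes k) * length (allFin (suc k))            ≡⟨ cong₂ _*_ (length-allCodes k) (length-tabulate id) ⟩
  k ! * suc k                                              ≡⟨ *-comm (k !) (suc k) ⟩
  suc k !                                                  ∎
  where open ≡-Reasoning

module _ {n : ℕ} where

  toStr : Code n × Code n → Str n
  toStr (c , c′) = Vec.tabulate (decode c) Vec.++ Vec.tabulate (decode c′)

  fOf-toStr : ∀ c c′ i → fOf (toStr (c , c′)) i ≡ decode c i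
  fOf-toStr c c′ i = trans (lookup-++ˡ (Vec.tabulate (decode c)) _ i) (lookup∘tabulate (decode c) i)

  gOf-toStr : ∀ c c′ i → gOf (toStr (c , c′)) i ≡ decode c′ i
  gOf-toStr c c′ i = trans (lookup-++ʳ (Vec.tabulate (decode c)) _ i) (lookup∘tabulate (decode c′) i)

  toStr-injective : ∀ {x y} → toStr x ≡ toStr y → x ≡ y
  toStr-injective {c , c′} {d , d′} eq with ++-injective (Vec.tabulate (decode c)) (Vec.tabulate (decode d)) eq
  ... | eqˡ , eqʳ =
    cong₂ _,_ (decode-≗-injective (tabulate-injective eqˡ)) (decode-≗-injective (tabulate-injective eqʳ))
    where
    tabulate-injective : ∀ {f g : Fin n → Fin n} → Vec.tabulate f ≡ Vec.tabulate g → ∀ i → f i ≡ g i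
    tabulate-injective {f} {g} eq i =
      trans (sym (lookup∘tabulate f i)) (trans (cong (λ v → Vec.lookup v i) eq) (lookup∘tabulate g i))

  toStr-permPair : ∀ x → PermPair (toStr x)
  toStr-permPair (c , c′) =
    isPerm (fOf-toStr c c′) (decode-injective c) , isPerm (gOf-toStr c c′) (decode-injective c′)
    where
    isPerm : ∀ {h k : Fin n → Fin n} → (∀ i → h i ≡ k i) → Injective _≡_ _≡_ k → IsPerm h
    isPerm {h} {k} h≗k k-inj = (λ _ _ → h-inj) , injective⇒surjective h-inj
      where
      h-inj : Injective _≡_ _≡_ h
      h-inj {x} {y} hx≡hy = k-inj (trans (sym (h≗k x)) (trans hx≡hy (h≗k y)))

codeCoincidences : ∀ {n} → Code n × Code n → ℕ
codeCoincidences (c , c′) = coincidences (decode c) (decode c′)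

allCodePairs : ∀ n → List (Code n × Code n)
allCodePairs n = cartesianProduct (allCodes n) (allCodes n)

toStr-far : ∀ {n} (x : Code n × Code n) → 5 * codeCoincidences x < 3 * n → FarFromInv 1 5 (toStr x)
toStr-far {n} x@(c , c′) few = few-coincidences⇒far (toStr x)
  (subst (λ k → 5 * k < 3 * n) (sym (coincidences-cong (fOf-toStr c c′) (gOf-toStr c c′))) few)

length-allCodePairs : ∀ n → length (allCodePairs n) ≡ n ! * n !
length-allCodePairs n = trans (length-cartesianProduct (allCodes n) (allCodes n))
  (cong₂ _*_ (length-allCodes n) (length-allCodes n))

sumOver : ∀ {A : Set} → List A → (A → ℕ) → ℕ
sumOver []       F = 0
sumOver (x ∷ xs) F = F x + sumOver xs F

sumOver-++ : ∀ {A : Set} (xs ys : List A) (F : A → ℕ) → sumOver (xs ++ ys) F ≡ sumOver xs F + sumOver ys F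
sumOver-++ []       ys F = refl
sumOver-++ (x ∷ xs) ys F = trans (cong (F x +_) (sumOver-++ xs ys F)) (sym (+-assoc (F x) _ _))

sumOver-cong : ∀ {A : Set} (xs : List A) {F G : A → ℕ} → (∀ x → F x ≡ G x) → sumOver xs F ≡ sumOver xs G
sumOver-cong []       F≗G = refl
sumOver-cong (x ∷ xs) F≗G = cong₂ _+_ (F≗G x) (sumOver-cong xs F≗G)

sumOver-const : ∀ {A : Set} (xs : List A) (k : ℕ) → sumOver xs (λ _ → k) ≡ length xs * k
sumOver-const []       k = refl
sumOver-const (x ∷ xs) k = cong (k +_) (sumOver-const xs k)

sumOver-map : ∀ {A B : Set} (f : A → B) (xs : List A) (F : B → ℕ) → sumOver (map f xs) F ≡ sumOver xs (F ∘ f)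
sumOver-map f []       F = refl
sumOver-map f (x ∷ xs) F = cong (F (f x) +_) (sumOver-map f xs F)

sumOver-cartesianProduct : ∀ {A B : Set} (xs : List A) (ys : List B) (F : A × B → ℕ) →
  sumOver (cartesianProduct xs ys) F ≡ sumOver xs (λ x → sumOver ys (λ y → F (x , y)))
sumOver-cartesianProduct []       ys F = refl
sumOver-cartesianProduct (x ∷ xs) ys F = trans (sumOver-++ (map (x ,_) ys) _ F)
  (cong₂ _+_ (sumOver-map (x ,_) ys F) (sumOver-cartesianProduct xs ys F))

sumOver-tabulate : ∀ {A : Set} {n} (g : Fin n → A) (F : A → ℕ) → sumOver (tabulate g) F ≡ ∑[ i < n ] F (g i)
sumOver-tabulate {n = zero}  g F = refl
sumOver-tabulate {n = suc n} g F = cong (F (g zero) +_) (sumOver-tabulate (g ∘ suc) F)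

markov : ∀ {A : Set} (K c : ℕ) (D : A → ℕ) (few? : ∀ x → Dec (c * D x < K)) (xs : List A) →
  K * length xs ≤ K * length (filter few? xs) + c * sumOver xs D
markov K c D few? []       = m≤m+n (K * 0) (c * 0)
markov K c D few? (x ∷ xs) with few? x | markov K c D few? xs
... | yes _    | ih = begin
  K * suc L                       ≡⟨ *-suc K L ⟩
  K + K * L                       ≤⟨ +-monoʳ-≤ K ih ⟩
  K + (K * G + c * S)             ≤⟨ m≤m+n _ (c * D x) ⟩
  K + (K * G + c * S) + c * D x   ≡⟨ kept K G c S (D x) ⟩
  K * suc G + c * (D x + S)       ∎
  where
  open ≤-Reasoning
  L = length xs
  G = length (filter few? xs)
  S = sumOver xs D
  kept : ∀ K G c S d → K + (K * G + c * S) + c * d ≡ K * suc G + c * (d + S)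
  kept = solve-∀
... | no  K≰cd | ih = begin
  K * suc L                       ≡⟨ *-suc K L ⟩
  K + K * L                       ≤⟨ +-mono-≤ (≮⇒≥ K≰cd) ih ⟩
  c * D x + (K * G + c * S)       ≡⟨ dropped K G c S (D x) ⟩
  K * G + c * (D x + S)           ∎
  where
  open ≤-Reasoning
  L = length xs
  G = length (filter few? xs)
  S = sumOver xs D
  dropped : ∀ K G c S d → c * d + (K * G + c * S) ≡ K * G + c * (d + S)
  dropped = solve-∀

-- The expected number of coincidences is 2

∑-matches-rotate : ∀ {n} (h f : Fin n → Fin n) → ∑[ r < n ] matches (rotate r ∘ h) f ≡ n
∑-matches-rotate {n} h f = begin
  ∑[ r < n ] ∑[ i < n ] 𝟙 (rotate r (h i) ≡ᵇ f i)
    ≡⟨ ∑-comm (λ r i → 𝟙 (rotate r (h i) ≡ᵇ f i)) ⟩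
  ∑[ i < n ] ∑[ r < n ] 𝟙 (rotate r (h i) ≡ᵇ f i)
    ≡⟨ sum-cong-≗ (λ i → ∑-𝟙-hits (rotate-injectiveˡ (h i)) (f i)) ⟩
  ∑[ i < n ] 1
    ≡⟨ ∑-const n 1 ⟩
  n * 1
    ≡⟨ *-identityʳ n ⟩
  n
    ∎
  where open ≡-Reasoning

∑-coincidences-rotate : ∀ {n} (f h : Fin n → Fin n) → ∑[ r < n ] coincidences f (rotate r ∘ h) ≡ n + n
∑-coincidences-rotate f h = trans
  (∑-distrib-+ (λ r → matches (rotate r ∘ h) f) (λ r → matches (rotate r ∘ h ∘ f) id))
  (cong₂ _+_ (∑-matches-rotate h f) (∑-matches-rotate (h ∘ f) id))

sumOver-coincidences : ∀ m (f : Fin (suc m) → Fin (suc m)) →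
  sumOver (allCodes (suc m)) (λ c → coincidences f (decode c)) ≡ m ! * (suc m + suc m)
sumOver-coincidences m f = begin
  sumOver (allCodes (suc m)) (λ c → coincidences f (decode c))
    ≡⟨ sumOver-cartesianProduct (allCodes m) (allFin n) _ ⟩
  sumOver (allCodes m) (λ c → sumOver (allFin n) (rotated c))
    ≡⟨ sumOver-cong (allCodes m) (λ c →
         trans (sumOver-tabulate id (rotated c)) (∑-coincidences-rotate f (lift 1 (decode c)))) ⟩
  sumOver (allCodes m) (λ _ → n + n)
    ≡⟨ sumOver-const (allCodes m) (n + n) ⟩
  length (allCodes m) * (n + n)
    ≡⟨ cong (_* (n + n)) (length-allCodes m) ⟩
  m ! * (n + n)
    ∎
  where
  open ≡-Reasoning
  n = suc m
  rotated : Code m → Fin n → ℕ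
  rotated c r = coincidences f (rotate r ∘ lift 1 (decode c))

sumOver-codeCoincidences : ∀ m → let n = suc m in sumOver (allCodePairs n) codeCoincidences ≡ 2 * (n ! * n !)
sumOver-codeCoincidences m = begin
  sumOver (allCodePairs n) codeCoincidences
    ≡⟨ sumOver-cartesianProduct (allCodes n) (allCodes n) codeCoincidences ⟩
  sumOver (allCodes n) (λ c → sumOver (allCodes n) (λ c′ → coincidences (decode c) (decode c′)))
    ≡⟨ sumOver-cong (allCodes n) (λ c → sumOver-coincidences m (decode c)) ⟩
  sumOver (allCodes n) (λ _ → m ! * (n + n))
    ≡⟨ sumOver-const (allCodes n) _ ⟩
  length (allCodes n) * (m ! * (n + n))
    ≡⟨ cong (_* (m ! * (n + n))) (length-allCodes n) ⟩
  n ! * (m ! * (n + n))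
    ≡⟨ regroup (m !) n ⟩
  2 * (n ! * n !)
    ∎
  where
  open ≡-Reasoning
  n = suc m
  regroup : ∀ a n → (n * a) * (a * (n + n)) ≡ 2 * ((n * a) * (n * a))
  regroup = solve-∀

eleven-twelfths : ∀ n N G .{{_ : NonZero N}} → 40 < n → 3 * n * N ≤ 3 * n * G + 5 * (2 * N) → 11 * N < 12 * G
eleven-twelfths n N G 40<n bound with 11 * N <? 12 * G
... | yes 11N<12G = 11N<12G
... | no  11N≮12G = contradiction (*-cancelʳ-≤ (3 * n) 120 N X≤120N) (<⇒≱ (*-monoʳ-< 3 40<n))
  where
  open ≤-Reasoning
  X = 3 * n * N
  X≤120N : X ≤ 120 * N
  X≤120N = +-cancelˡ-≤ (11 * X) X (120 * N) (begin
    11 * X + X                    ≡⟨ e₁ n N ⟩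
    12 * X                        ≤⟨ *-monoʳ-≤ 12 bound ⟩
    12 * (3 * n * G + 5 * (2 * N)) ≡⟨ e₂ n G N ⟩
    3 * n * (12 * G) + 120 * N    ≤⟨ +-monoˡ-≤ (120 * N) (*-monoʳ-≤ (3 * n) (≮⇒≥ 11N≮12G)) ⟩
    3 * n * (11 * N) + 120 * N    ≡⟨ e₃ n N ⟩
    11 * X + 120 * N              ∎)
    where
    e₁ : ∀ n N → 11 * (3 * n * N) + 3 * n * N ≡ 12 * (3 * n * N)
    e₁ = solve-∀
    e₂ : ∀ n G N → 12 * (3 * n * G + 5 * (2 * N)) ≡ 3 * n * (12 * G) + 120 * N
    e₂ = solve-∀
    e₃ : ∀ n N → 3 * n * (11 * N) + 120 * N ≡ 11 * (3 * n * N) + 120 * N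
    e₃ = solve-∀

mainTheorem13 : (n : ℕ) → 60 < n →
    Σ (List (Str n)) (λ good →
      Unique good × All (λ s → PermPair s × FarFromInv 1 5 s) good
        × 11 * ((n !) * (n !)) < 12 * length good)
mainTheorem13 n@(suc m) 60<n =
    map toStr far
  , map⁺ toStr-injective (filter⁺ few? (cartesianProduct⁺ (allCodes-unique n) (allCodes-unique n)))
  , All-map⁺ (All.map (λ {x} few → toStr-permPair x , toStr-far x few) (all-filter few? (allCodePairs n)))
  , subst (λ k → 11 * N < 12 * k) (sym (length-map toStr far))
      (eleven-twelfths n N (length far) {{n !* n !≢0}} (≤-trans (m≤m+n 41 20) 60<n) bound)
  where
  few? : ∀ x → Dec (5 * codeCoincidences x < 3 * n)
  few? x = 5 * codeCoincidences x <? 3 * n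
  far = filter few? (allCodePairs n)
  N = n ! * n !
  bound : 3 * n * N ≤ 3 * n * length far + 5 * (2 * N)
  bound = subst₂ (λ a b → 3 * n * a ≤ 3 * n * length far + 5 * b)
    (length-allCodePairs n) (sumOver-codeCoincidences m) (markov (3 * n) 5 codeCoincidences few? (allCodePairs n))
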